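{- If $S$ is a null semigroup of size $p$, then its degree is $\mu(S)=\min\{n\in\mathbb N : \xi(n)\geq p\}$.
   Context: A null semigroup is a semigroup $S$ with $S^2=\{z\}$ for some $z\in S$. The degree $\mu(S)$ of a finite semigroup $S$ is the least $n\geq1$ such that $S$ embeds in the full transformation semigroup $\mathcal T_n$ of all self-maps of $\{1,\dots,n\}$. For $n\in\mathbb N$, $\xi(n)=\max\{t^{n-t}: t\in\{1,\dots,n\}\}$ (with $0^0=1$). -}

module Defs where

open import Data.Nat using (ℕ; zero; suc; _^_; _∸_; _≤_; _⊔_)
open import Data.Fin using (Fin)
open import Data.List using (List; map; foldr; upTo)
open import Data.Product using (Σ; _×_)
open import Function using (_∘_)
open import Relation.Binary.PropositionalEquality using (_≡_; _≗_)
open import Algebra.Structures using (IsSemigroup)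

record FinSemigroup (p : ℕ) : Set where
  field
    _∙_         : Fin p → Fin p → Fin p
    isSemigroup : IsSemigroup {A = Fin p} _≡_ _∙_

IsNull : ∀ {p} → FinSemigroup p → Set
IsNull {p} S = Σ (Fin p) λ z → ∀ x y → x ∙ y ≡ z
  where open FinSemigroup S

-- Full transformation semigroup T_n: maps Fin n → Fin n under composition,
-- with (extensional) pointwise equality.
-- S embeds in T_n: an injective semigroup homomorphism S → T_n.
EmbedsIn : ∀ {p} → FinSemigroup p → ℕ → Set
EmbedsIn {p} S n =
  Σ (Fin p → (Fin n → Fin n)) λ f →
    (∀ x y → f (x ∙ y) ≗ (f x ∘ f y)) ×
    (∀ x y → f x ≗ f y → x ≡ y)
  where open FinSemigroup S

IsDegree : ∀ {p} → FinSemigroup p → ℕ → Set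
IsDegree S n = (1 ≤ n) × EmbedsIn S n × (∀ m → 1 ≤ m → EmbedsIn S m → n ≤ m)

-- ξ(n) = max { t^(n-t) : t ∈ {1,…,n} }  (ξ 0 = 0, empty max; never used since n ≥ 1)
ξ : ℕ → ℕ
ξ n = foldr _⊔_ 0 (map (λ t → t ^ (n ∸ t)) (map suc (upTo n)))

IsLeastXi : ℕ → ℕ → Set
IsLeastXi p n = (1 ≤ n) × (p ≤ ξ n) × (∀ m → 1 ≤ m → p ≤ ξ m → n ≤ m)

-- Let f embed a null semigroup S with zero z into T_n and let U be the union of the images of the
-- maps f s. Since f s ∘ f g = f (s g) = f z = f (s′ g) = f s′ ∘ f g, all f s agree on U, so f s is
-- determined by its restriction to the complement of U, a map into U; with c = |U| ≥ 1 this gives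
-- |S| ≤ c ^ (n ∸ c) ≤ ξ n. Conversely, if |S| ≤ t ^ (n ∸ t), code S injectively by maps from an
-- (n ∸ t)-set into a t-set, the zero by a constant map, and let s collapse the t-set to that constant
-- and map the (n ∸ t)-set into the t-set by its code. So S embeds in T_n iff |S| ≤ ξ n.
module Submission where

open import Defs
open import Data.Nat using (ℕ; zero; suc; _+_; _^_; _∸_; _≤_; _<_; _⊔_; _≤?_; z≤n; s≤s; >-nonZero⁻¹)
open import Data.Nat.Properties
open import Data.Nat.Induction using (<-rec)
open import Data.Fin using (Fin; fromℕ<; inject≤; splitAt; _↑ˡ_; _↑ʳ_; combine; funToFin; finToFun)
  renaming (zero to fzero; suc to fsuc)
import Data.Fin.Properties as Fin
open import Data.Fin.Permutation.Components using (transpose; transpose-inverse)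
open import Data.List using (List; []; _∷_; map; foldr; upTo; filter; allFin; length; lookup)
open import Data.List.Properties using (length-tabulate)
open import Data.List.Membership.Propositional using (_∈_)
open import Data.List.Membership.Propositional.Properties
  using (∈-map⁺; ∈-map⁻; ∈-upTo⁺; ∈-upTo⁻; ∈-filter⁺; ∈-allFin; foldr-selective)
open import Data.List.Relation.Unary.Any using (here; there; index)
open import Data.List.Relation.Unary.Any.Properties using (lookup-index)
open import Data.Product using (Σ; _×_; _,_; ∃; ∃₂)
open import Data.Sum using (_⊎_; inj₁; inj₂; [_,_]′)
open import Function using (_∘_; const; id)
open import Relation.Binary.PropositionalEquality
open import Relation.Nullary using (yes; no; ¬_; contradiction)
open import Relation.Nullary.Decidable using (dec-true; _×-dec_)
open import Relation.Unary using (Pred; Decidable)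
open import Relation.Unary.Properties using (∁?)

module _ {ℓ} {P : Pred ℕ ℓ} (P? : Decidable P) where

  LeastWitness : Set ℓ
  LeastWitness = ∃ λ m → P m × (∀ k → P k → m ≤ k)

  least-witness : ∀ n → P n → LeastWitness
  least-witness = <-rec (λ n → P n → LeastWitness) search
    where
    search : ∀ n → (∀ {k} → k < n → P k → LeastWitness) → P n → LeastWitness
    search n below pn with anyUpTo? P? n
    ... | yes (k , k<n , pk) = below k<n pk
    ... | no none            = n , pn , λ k pk → ≮⇒≥ (λ k<n → none (k , k<n , pk))

length-filter+length-filter-∁ : ∀ {a ℓ} {A : Set a} {P : Pred A ℓ} (P? : Decidable P) xs →
  length (filter P? xs) + length (filter (∁? P?) xs) ≡ length xs
length-filter+length-filter-∁ P? []       = refl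
length-filter+length-filter-∁ P? (x ∷ xs) with P? x
... | yes _ = cong suc (length-filter+length-filter-∁ P? xs)
... | no  _ = trans (+-suc _ _) (cong suc (length-filter+length-filter-∁ P? xs))

module Partition {m ℓ} {U : Pred (Fin m) ℓ} (U? : Decidable U) where

  inside outside : List (Fin m)
  inside  = filter U? (allFin m)
  outside = filter (∁? U?) (allFin m)

  rank : ∀ {v} → U v → Fin (length inside)
  rank {v} u = index (∈-filter⁺ U? (∈-allFin v) u)

  rank-injective : ∀ {v w} (u : U v) (u′ : U w) → rank u ≡ rank u′ → v ≡ w
  rank-injective {v} {w} u u′ eq = begin
    v                        ≡⟨ lookup-index (∈-filter⁺ U? (∈-allFin v) u) ⟩
    lookup inside (rank u)   ≡⟨ cong (lookup inside) eq ⟩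
    lookup inside (rank u′)  ≡⟨ lookup-index (∈-filter⁺ U? (∈-allFin w) u′) ⟨
    w                        ∎
    where open ≡-Reasoning

  lookup-outside : ∀ {w} → ¬ U w → ∃ λ j → lookup outside j ≡ w
  lookup-outside {w} w∉U = _ , sym (lookup-index (∈-filter⁺ (∁? U?) (∈-allFin w) w∉U))

  length-inside+outside : length inside + length outside ≡ m
  length-inside+outside = trans (length-filter+length-filter-∁ U? (allFin m)) (length-tabulate id)

≤-foldr-⊔ : ∀ {x xs} → x ∈ xs → x ≤ foldr _⊔_ 0 xs
≤-foldr-⊔ (here refl)                  = m≤m⊔n _ _
≤-foldr-⊔ {xs = y ∷ _} (there x∈xs) = m≤n⇒m≤o⊔n y (≤-foldr-⊔ x∈xs)

t^[n∸t]≤ξ : ∀ {n t} → 1 ≤ t → t ≤ n → t ^ (n ∸ t) ≤ ξ n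
t^[n∸t]≤ξ {n} {suc t} _ t<n = ≤-foldr-⊔ (∈-map⁺ (λ t → t ^ (n ∸ t)) (∈-map⁺ suc (∈-upTo⁺ t<n)))

ξ-attained : ∀ {n} → 1 ≤ ξ n → ∃ λ t → 1 ≤ t × t ≤ n × ξ n ≡ t ^ (n ∸ t)
ξ-attained {n} 1≤ξ with foldr-selective ⊔-sel 0 (map (λ t → t ^ (n ∸ t)) (map suc (upTo n)))
... | inj₁ ξ≡0 = contradiction (subst (1 ≤_) ξ≡0 1≤ξ) λ ()
... | inj₂ ξ∈  with ∈-map⁻ (λ t → t ^ (n ∸ t)) ξ∈
... | t , t∈ , ξ≡ with ∈-map⁻ suc t∈
... | i , i∈ , refl = suc i , s≤s z≤n , ∈-upTo⁻ i∈ , ξ≡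

n≤ξ[1+n] : ∀ n → n ≤ ξ (suc n)
n≤ξ[1+n] zero    = z≤n
n≤ξ[1+n] (suc n) = subst (_≤ ξ (2 + n)) (trans (cong (suc n ^_) (m+n∸n≡m 1 n)) (^-identityʳ (suc n)))
                         (t^[n∸t]≤ξ (s≤s z≤n) (n≤1+n (suc n)))

funToFin-cong : ∀ {m n} {f g : Fin m → Fin n} → f ≗ g → funToFin f ≡ funToFin g
funToFin-cong {zero}  _   = refl
funToFin-cong {suc m} f≗g = cong₂ combine (f≗g fzero) (funToFin-cong (f≗g ∘ fsuc))

finToFun-injective : ∀ {m n} {i j : Fin (m ^ n)} → finToFun {m} {n} i ≗ finToFun j → i ≡ j
finToFun-injective {m} {n} {i} {j} i≗j = begin
  i                              ≡⟨ Fin.funToFin-finToFin {n} {m} i ⟨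
  funToFin {n} {m} (finToFun i)  ≡⟨ funToFin-cong i≗j ⟩
  funToFin {n} {m} (finToFun j)  ≡⟨ Fin.funToFin-finToFin {n} {m} j ⟩
  j                              ∎
  where open ≡-Reasoning

pointwise-injective⇒≤^ : ∀ {p k c} (F : Fin p → Fin k → Fin c) →
                         (∀ s s′ → F s ≗ F s′ → s ≡ s′) → p ≤ c ^ k
pointwise-injective⇒≤^ F F-injective = Fin.injective⇒≤ λ {s} {s′} eq → F-injective s s′ λ j → begin
  F s j                        ≡⟨ Fin.finToFun-funToFin (F s) j ⟨
  finToFun (funToFin (F s)) j  ≡⟨ cong (λ i → finToFun i j) eq ⟩
  finToFun (funToFin (F s′)) j ≡⟨ Fin.finToFun-funToFin (F s′) j ⟩
  F s′ j                       ∎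
  where open ≡-Reasoning

transpose-sends : ∀ {n} (i j : Fin n) → transpose i j i ≡ j
transpose-sends i j rewrite dec-true (i Fin.≟ i) refl = refl

transpose-injective : ∀ {n} (i j : Fin n) {x y} → transpose i j x ≡ transpose i j y → x ≡ y
transpose-injective i j {x} {y} eq = begin
  x                               ≡⟨ transpose-inverse j i ⟨
  transpose j i (transpose i j x) ≡⟨ cong (transpose j i) eq ⟩
  transpose j i (transpose i j y) ≡⟨ transpose-inverse j i ⟩
  y                               ∎
  where open ≡-Reasoning

pointed-injection : ∀ {p q} → p ≤ q → (a : Fin p) (b : Fin q) →
                    Σ (Fin p → Fin q) λ g → (∀ x y → g x ≡ g y → x ≡ y) × g a ≡ b
pointed-injection {p} {q} p≤q a b = g , g-injective , transpose-sends (inject≤ a p≤q) b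
  where
  g : Fin p → Fin q
  g x = transpose (inject≤ a p≤q) b (inject≤ x p≤q)
  g-injective : ∀ x y → g x ≡ g y → x ≡ y
  g-injective x y eq = Fin.inject≤-injective p≤q p≤q x y (transpose-injective _ _ eq)

module Collapse {p k t} (code : Fin p → Fin k → Fin (suc t)) where

  base : Fin (suc t + k)
  base = fzero ↑ˡ k

  act : Fin p → Fin (suc t) ⊎ Fin k → Fin (suc t + k)
  act s = [ const base , (λ j → code s j ↑ˡ k) ]′

  collapse : Fin p → Fin (suc t + k) → Fin (suc t + k)
  collapse s = act s ∘ splitAt (suc t)

  collapse-∘ : ∀ s s′ → collapse s ∘ collapse s′ ≗ const base
  collapse-∘ s s′ x with splitAt (suc t) x
  ... | inj₁ _ = cong (act s) (Fin.splitAt-↑ˡ (suc t) fzero k)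
  ... | inj₂ j = cong (act s) (Fin.splitAt-↑ˡ (suc t) (code s′ j) k)

  collapse-const : ∀ s → code s ≗ const fzero → collapse s ≗ const base
  collapse-const s code≗0 x with splitAt (suc t) x
  ... | inj₁ _ = refl
  ... | inj₂ j = cong (_↑ˡ k) (code≗0 j)

  collapse≗⇒code≗ : ∀ s s′ → collapse s ≗ collapse s′ → code s ≗ code s′
  collapse≗⇒code≗ s s′ eq j = Fin.↑ˡ-injective k _ _ (begin
    code s j ↑ˡ k               ≡⟨ cong (act s) (Fin.splitAt-↑ʳ (suc t) k j) ⟨
    collapse s (suc t ↑ʳ j)     ≡⟨ eq (suc t ↑ʳ j) ⟩
    collapse s′ (suc t ↑ʳ j)    ≡⟨ cong (act s′) (Fin.splitAt-↑ʳ (suc t) k j) ⟩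
    code s′ j ↑ˡ k              ∎)
    where open ≡-Reasoning

module _ {p m} (F : Fin p → Fin m → Fin m) where

  InImage : Pred (Fin m) _
  InImage v = ∃₂ λ s w → F s w ≡ v

  inImage? : Decidable InImage
  inImage? v = Fin.any? λ s → Fin.any? λ w → F s w Fin.≟ v

  agreeing-on-images⇒≤ξ : (∀ s s′ g → F s ∘ F g ≗ F s′ ∘ F g) → (∀ s s′ → F s ≗ F s′ → s ≡ s′) →
                          Fin p → Fin m → p ≤ ξ m
  agreeing-on-images⇒≤ξ agree F-injective s₀ w₀ = begin
    p            ≤⟨ pointwise-injective⇒≤^ code code-injective ⟩
    c ^ k        ≡⟨ cong (c ^_) k≡m∸c ⟩
    c ^ (m ∸ c)  ≤⟨ t^[n∸t]≤ξ 1≤c c≤m ⟩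
    ξ m          ∎
    where
    open ≤-Reasoning
    open Partition inImage?

    c k : ℕ
    c = length inside
    k = length outside

    code : Fin p → Fin k → Fin c
    code s j = rank (s , lookup outside j , refl)

    code-injective : ∀ s s′ → code s ≗ code s′ → s ≡ s′
    code-injective s s′ code≗ = F-injective s s′ F≗
      where
      F≗ : F s ≗ F s′
      F≗ w with inImage? w
      ... | yes (g , v , refl) = agree s s′ g v
      ... | no w∉ with lookup-outside w∉
      ... | j , refl = rank-injective _ _ (code≗ j)

    1≤c : 1 ≤ c
    1≤c = >-nonZero⁻¹ c {{Fin.nonZeroIndex (rank (s₀ , w₀ , refl))}}

    c≤m : c ≤ m
    c≤m = subst (c ≤_) length-inside+outside (m≤m+n c k)

    k≡m∸c : k ≡ m ∸ c
    k≡m∸c = trans (sym (m+n∸m≡n c k)) (cong (_∸ c) length-inside+outside)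

module _ {p} (S : FinSemigroup p) where
  open FinSemigroup S

  null-embeds : IsNull S → ∀ {t k} → p ≤ suc t ^ k → EmbedsIn S (suc t + k)
  null-embeds (z , null) {t} {k} p≤ with pointed-injection p≤ z (funToFin {k} (const fzero))
  ... | g , g-injective , g-z = collapse , collapse-hom , collapse-injective
    where
    code : Fin p → Fin k → Fin (suc t)
    code = finToFun ∘ g
    open Collapse code

    code-z : code z ≗ const fzero
    code-z j = trans (cong (λ i → finToFun i j) g-z) (Fin.finToFun-funToFin (const fzero) j)

    collapse-hom : ∀ x y → collapse (x ∙ y) ≗ collapse x ∘ collapse y
    collapse-hom x y w = begin
      collapse (x ∙ y) w         ≡⟨ cong (λ s → collapse s w) (null x y) ⟩
      collapse z w               ≡⟨ collapse-const z code-z w ⟩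
      base                       ≡⟨ collapse-∘ x y w ⟨
      collapse x (collapse y w)  ∎
      where open ≡-Reasoning

    collapse-injective : ∀ s s′ → collapse s ≗ collapse s′ → s ≡ s′
    collapse-injective s s′ eq = g-injective s s′ (finToFun-injective {suc t} {k} (collapse≗⇒code≗ s s′ eq))

  ≤ξ⇒embeds : IsNull S → ∀ {m} → p ≤ ξ m → EmbedsIn S m
  ≤ξ⇒embeds null@(z , _) {m} p≤ξ with ξ-attained (≤-trans (>-nonZero⁻¹ p {{Fin.nonZeroIndex z}}) p≤ξ)
  ... | suc t , _ , t≤m , ξ≡ =
    subst (EmbedsIn S) (m+[n∸m]≡n t≤m) (null-embeds null {t} {m ∸ suc t} (subst (p ≤_) ξ≡ p≤ξ))

  embeds⇒≤ξ : IsNull S → ∀ {m} → 1 ≤ m → EmbedsIn S m → p ≤ ξ m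
  embeds⇒≤ξ (z , null) 1≤m (f , hom , f-injective) =
    agreeing-on-images⇒≤ξ f agree f-injective z (fromℕ< 1≤m)
    where
    agree : ∀ s s′ g → f s ∘ f g ≗ f s′ ∘ f g
    agree s s′ g w = begin
      f s (f g w)   ≡⟨ hom s g w ⟨
      f (s ∙ g) w   ≡⟨ cong (λ x → f x w) (trans (null s g) (sym (null s′ g))) ⟩
      f (s′ ∙ g) w  ≡⟨ hom s′ g w ⟩
      f s′ (f g w)  ∎
      where open ≡-Reasoning

theorem4p7 : (p : ℕ) (S : FinSemigroup p) → IsNull S →
    Σ ℕ λ n → IsDegree S n × IsLeastXi p n
theorem4p7 p S null with least-witness (λ n → (1 ≤? n) ×-dec (p ≤? ξ n)) (suc p) (s≤s z≤n , n≤ξ[1+n] p)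
... | n , (1≤n , p≤ξn) , least =
  n , (1≤n , ≤ξ⇒embeds S null p≤ξn , λ m 1≤m S↪Tm → least m (1≤m , embeds⇒≤ξ S null 1≤m S↪Tm))
    , (1≤n , p≤ξn , λ m 1≤m p≤ξm → least m (1≤m , p≤ξm))
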